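{- Let $t\ge 3$ be an odd integer, let $d$ be a positive integer, and let $S=(d,d,d,\ldots)$. Then $$\chi_S(G_t)\le \begin{cases} 1+d(d+1), & \text{if } d\le \frac{t+1}{2},\\[2pt] td+\frac{1}{4}\left(-t^2+2t+7\right), & \text{if } d\ge \frac{t+1}{2}.\end{cases}$$
   Context: For an odd integer $t\ge 3$, $G_t$ denotes the integer distance graph $G(\mathbb{Z},\{2,t\})$: its vertex set is $\mathbb{Z}$, and distinct $i,j\in\mathbb{Z}$ are adjacent if and only if $|i-j|\in\{2,t\}$. For a graph $G$ and a non-decreasing sequence $S=(a_1,a_2,\ldots)$ of positive integers, an $S$-packing $k$-coloring of $G$ is a map $f:V(G)\to\{1,\ldots,k\}$ such that any two distinct vertices $u,v$ with $f(u)=f(v)=i$ satisfy $d_G(u,v)>a_i$, where $d_G$ is the shortest-path distance. The $S$-packing chromatic number $\chi_S(G)$ is the smallest $k$ for which $G$ has an $S$-packing $k$-coloring. -}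

module Defs where

open import Data.Nat using (ℕ; zero; suc; _≤_)
open import Data.Product using (∃; _×_)
open import Data.Integer using (ℤ; _-_; ∣_∣)
open import Data.Fin using (Fin; toℕ)
open import Data.Sum using (_⊎_)
open import Relation.Binary.PropositionalEquality using (_≡_; _≢_)
open import Relation.Nullary using (¬_)

Graphℤ : Set₁
Graphℤ = ℤ → ℤ → Set

G : ℕ → Graphℤ
G t i j = (∣ i - j ∣ ≡ 2) ⊎ (∣ i - j ∣ ≡ t)

-- WithinDist Adj k u v : there is a walk of length ≤ k from u to v,
-- i.e. the shortest-path distance satisfies d(u,v) ≤ k.
data WithinDist (Adj : Graphℤ) : ℕ → ℤ → ℤ → Set where
  here : ∀ {k u} → WithinDist Adj k u u
  step : ∀ {k u w v} → Adj u w → WithinDist Adj k w v → WithinDist Adj (suc k) u v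

-- S-packing k-coloring, S = (a₁, a₂, …) given as S : ℕ → ℕ with S i = a_{i+1};
-- colour i ∈ Fin k stands for colour i+1 ∈ {1,…,k}.
IsSPackingColoring : Graphℤ → (ℕ → ℕ) → (k : ℕ) → (ℤ → Fin k) → Set
IsSPackingColoring Adj S k f =
  ∀ u v → u ≢ v → f u ≡ f v → ¬ WithinDist Adj (S (toℕ (f u))) u v

χ≤ : Graphℤ → (ℕ → ℕ) → ℕ → Set
χ≤ Adj S N = ∃ λ k → (k ≤ N) × ∃ (IsSPackingColoring Adj S k)

-- A walk of length at most d in G_t consists of α, α′, β, β′ moves by +2, −2, +t, −t with
-- α + α′ + β + β′ ≤ d, so every vertex within distance d of u is u + o for a displacement
-- o = 2(α − α′) + t(β − β′), and a colouring c of ℤ is an S-packing as soon as c(u + o) ≠ c(u)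
-- for every positive displacement o.
--
-- If 2d ≤ t + 1 there are at most d(d + 1) positive displacements: 2a for 1 ≤ a ≤ d, and
-- tb + 2a for 1 ≤ b ≤ d and |a| ≤ d − b. A greedy colouring of 0, 1, 2, … and then of −1, −2, …
-- therefore never needs more than d(d + 1) + 1 colours.
--
-- If 2d ≥ t + 1, colour u by u mod p. With t = 2n + 3 and p = (t − 2)b + 2d + 2, p lies above every
-- displacement with at most b net t-moves, below every one with b + 2 or more (as long as
-- 2d ≤ 2b + t), and has the wrong parity for b + 1; as displacements are at most td < 2p, no
-- multiple of p is one. Choosing b = ⌊n/2⌋ + 1 + (d − n − 2) makes 4p ≤ 4td − t² + 2t + 7.
module Submission where

open import Defs
open import Data.Nat using (ℕ; zero; suc; z<s; s≤s⁻¹; s<s⁻¹; _≤_; _<_; _+_; _*_; _∸_; _%_; s≤s; z≤n; NonZero; _≤?_; _<?_)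
open import Data.Nat.Properties
open import Data.Nat.DivMod using (m*n%n≡0)
open import Data.Integer.DivMod using (_%ℕ_; _/ℕ_; n%ℕd<d; a≡a%ℕn+[a/ℕn]*n)
open import Data.Integer using (ℤ; +_; -[1+_]; -_; _-_; _⊖_; ∣_∣; +≤+)
  renaming (_+_ to _+ℤ_; _*_ to _*ℤ_; _≤_ to _≤ℤ_)
import Data.Integer.Properties as ℤ
open import Data.Product using (∃; ∃-syntax; Σ-syntax; _×_; _,_; proj₁; proj₂)
open import Data.Fin using (Fin; fromℕ<) renaming (zero to fzero)
open import Data.List using (List; length; map; lookup; upTo; downFrom; concatMap; _++_)
open import Data.List.Properties using (length-map; length-++; length-upTo)
open import Data.List.Membership.Propositional using (_∈_; _∉_)
open import Data.List.Membership.Propositional.Properties using (∈-map⁺; ∈-++⁺ˡ; ∈-++⁺ʳ; ∈-upTo⁺; ∈-downFrom⁺; ∈-concat⁺′)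
import Data.List.Membership.DecPropositional as DecMembership
open import Data.List.Relation.Unary.Any using (index)
open import Data.List.Relation.Unary.Any.Properties using (lookup-index)
import Data.Fin.Properties as Fin
open import Function using (_∘_)
open import Data.Sum using (_⊎_; inj₁; inj₂)
open import Relation.Binary.PropositionalEquality
open import Relation.Binary.Definitions using (tri<; tri≈; tri>)
open import Relation.Nullary using (¬_; yes; no; contradiction)
import Data.Nat.Tactic.RingSolver as ℕ-Solver
import Data.Integer.Tactic.RingSolver as ℤ-Solver

record Moves (k : ℕ) : Set where
  constructor moves
  field
    α α′ β β′ : ℕ
    count≤ : α + α′ + β + β′ ≤ k

up down : ∀ {k} → ℕ → Moves k → ℕ
up t (moves α _ β _ _) = 2 * α + t * β
down t (moves _ α′ _ β′ _) = 2 * α′ + t * β′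

no-moves : ∀ {k} → Moves k
no-moves = moves 0 0 0 0 z≤n

reverse : ∀ {k} → Moves k → Moves k
reverse {k} (moves α α′ β β′ c) = moves α′ α β′ β (subst (_≤ k) (swap α α′ β β′) c)
  where
  swap : ∀ a a′ b b′ → a + a′ + b + b′ ≡ a′ + a + b′ + b
  swap = ℕ-Solver.solve-∀

add-up-move : ∀ t {k n} → n ≡ 2 ⊎ n ≡ t → (m : Moves k) →
              Σ[ m′ ∈ Moves (suc k) ] up t m′ ≡ up t m + n × down t m′ ≡ down t m
add-up-move t (inj₁ refl) (moves α α′ β β′ c) = moves (suc α) α′ β β′ (s≤s c) , shift t α β , refl
  where
  shift : ∀ t a b → 2 * suc a + t * b ≡ 2 * a + t * b + 2
  shift = ℕ-Solver.solve-∀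
add-up-move t {k} (inj₂ refl) (moves α α′ β β′ c) =
  moves α α′ (suc β) β′ (subst (_≤ suc k) (count α α′ β β′) (s≤s c)) , shift t α β , refl
  where
  count : ∀ a a′ b b′ → suc (a + a′ + b + b′) ≡ a + a′ + suc b + b′
  count = ℕ-Solver.solve-∀
  shift : ∀ t a b → 2 * a + t * suc b ≡ 2 * a + t * b + t
  shift = ℕ-Solver.solve-∀

∣x∣≡n⇒x≡±n : ∀ x {n} → ∣ x ∣ ≡ n → x ≡ + n ⊎ x ≡ - + n
∣x∣≡n⇒x≡±n (+ m) refl = inj₁ refl
∣x∣≡n⇒x≡±n -[1+ m ] refl = inj₂ refl

∣u-w∣≡n⇒ : ∀ u w {n} → ∣ u - w ∣ ≡ n → w ≡ u +ℤ + n ⊎ u ≡ w +ℤ + n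
∣u-w∣≡n⇒ u w {n} e with ∣x∣≡n⇒x≡±n (u - w) e
... | inj₁ u-w≡n = inj₂ (trans (u≡w+[u-w] u w) (cong (w +ℤ_) u-w≡n))
  where
  u≡w+[u-w] : ∀ u w → u ≡ w +ℤ (u - w)
  u≡w+[u-w] = ℤ-Solver.solve-∀
... | inj₂ u-w≡-n = inj₁ (begin
  w                   ≡⟨ w≡u-[u-w] u w ⟩
  u +ℤ - (u - w)      ≡⟨ cong (λ x → u +ℤ - x) u-w≡-n ⟩
  u +ℤ - (- + n)      ≡⟨ cong (u +ℤ_) (ℤ.neg-involutive (+ n)) ⟩
  u +ℤ + n            ∎)
  where
  open ≡-Reasoning
  w≡u-[u-w] : ∀ u w → w ≡ u +ℤ - (u - w)
  w≡u-[u-w] = ℤ-Solver.solve-∀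

adjacent⇒ : ∀ {t u w} → G t u w → ∃[ n ] (n ≡ 2 ⊎ n ≡ t) × (w ≡ u +ℤ + n ⊎ u ≡ w +ℤ + n)
adjacent⇒ {u = u} {w} (inj₁ e) = _ , inj₁ refl , ∣u-w∣≡n⇒ u w e
adjacent⇒ {u = u} {w} (inj₂ e) = _ , inj₂ refl , ∣u-w∣≡n⇒ u w e

balance-after-up : ∀ (u v : ℤ) X Y n → v +ℤ + X ≡ (u +ℤ + n) +ℤ + Y → v +ℤ + X ≡ u +ℤ + (Y + n)
balance-after-up u v X Y n h = trans h (trans (reassoc u (+ n) (+ Y)) (cong (u +ℤ_) (sym (ℤ.pos-+ Y n))))
  where
  reassoc : ∀ u n y → (u +ℤ n) +ℤ y ≡ u +ℤ (y +ℤ n)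
  reassoc = ℤ-Solver.solve-∀

balance-after-down : ∀ (w v : ℤ) X Y n → v +ℤ + X ≡ w +ℤ + Y → v +ℤ + (X + n) ≡ (w +ℤ + n) +ℤ + Y
balance-after-down w v X Y n h = begin
  v +ℤ + (X + n)        ≡⟨ cong (v +ℤ_) (ℤ.pos-+ X n) ⟩
  v +ℤ (+ X +ℤ + n)     ≡⟨ sym (ℤ.+-assoc v (+ X) (+ n)) ⟩
  v +ℤ + X +ℤ + n       ≡⟨ cong (_+ℤ + n) h ⟩
  w +ℤ + Y +ℤ + n       ≡⟨ reassoc w (+ Y) (+ n) ⟩
  (w +ℤ + n) +ℤ + Y     ∎
  where
  open ≡-Reasoning
  reassoc : ∀ w y n → w +ℤ y +ℤ n ≡ (w +ℤ n) +ℤ y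
  reassoc = ℤ-Solver.solve-∀

walk⇒moves : ∀ {t k u v} → WithinDist (G t) k u v → Σ[ m ∈ Moves k ] v +ℤ + down t m ≡ u +ℤ + up t m
walk⇒moves here = no-moves , refl
walk⇒moves {t} {u = u} {v} (step {w = w} adj walk) with walk⇒moves walk | adjacent⇒ {t} {u} {w} adj
... | m , bal | n , size , inj₁ refl with add-up-move t size m
...   | m′ , up≡ , down≡ =
  m′ , subst₂ (λ x y → v +ℤ + x ≡ u +ℤ + y) (sym down≡) (sym up≡) (balance-after-up u v _ _ n bal)
walk⇒moves {t} {u = u} {v} (step {w = w} adj walk) | m , bal | n , size , inj₂ refl with add-up-move t size (reverse m)
...   | m′ , up≡ , down≡ =
  reverse m′ , subst₂ (λ x y → v +ℤ + x ≡ (w +ℤ + n) +ℤ + y) (sym up≡) (sym down≡) (balance-after-down w v _ _ n bal)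

Displacement : ℕ → ℕ → ℕ → Set
Displacement t d o = Σ[ m ∈ Moves d ] o + down t m ≡ up t m

+ℤ-cancelʳ : ∀ {x y} a → x +ℤ a ≡ y +ℤ a → x ≡ y
+ℤ-cancelʳ {x} {y} a h = begin
  x                 ≡⟨ x≡x+a-a x a ⟩
  x +ℤ a +ℤ - a     ≡⟨ cong (_+ℤ - a) h ⟩
  y +ℤ a +ℤ - a     ≡⟨ sym (x≡x+a-a y a) ⟩
  y                 ∎
  where
  open ≡-Reasoning
  x≡x+a-a : ∀ x a → x ≡ x +ℤ a +ℤ - a
  x≡x+a-a = ℤ-Solver.solve-∀

increasing-displacement : ∀ {t d} {u v : ℤ} (m : Moves d) →
  v +ℤ + down t m ≡ u +ℤ + up t m → down t m < up t m →
  ∃[ o ] 0 < o × Displacement t d o × v ≡ u +ℤ + o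
increasing-displacement {t} {u = u} {v} m bal X<Y with m≤n⇒∃[o]m+o≡n X<Y
... | o , X+1+o≡Y = suc o , z<s , (m , o+X≡Y) , +ℤ-cancelʳ (+ X) (begin
  v +ℤ + X                 ≡⟨ bal ⟩
  u +ℤ + up t m            ≡⟨ cong (λ y → u +ℤ + y) (sym o+X≡Y) ⟩
  u +ℤ + (suc o + X)       ≡⟨ cong (u +ℤ_) (ℤ.pos-+ (suc o) X) ⟩
  u +ℤ (+ suc o +ℤ + X)    ≡⟨ sym (ℤ.+-assoc u (+ suc o) (+ X)) ⟩
  u +ℤ + suc o +ℤ + X      ∎)
  where
  open ≡-Reasoning
  X = down t m
  o+X≡Y : suc o + X ≡ up t m
  o+X≡Y = trans (cong suc (+-comm o X)) X+1+o≡Y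

close⇒displacement : ∀ {t d u v} → WithinDist (G t) d u v → u ≢ v →
  ∃[ o ] 0 < o × Displacement t d o × (v ≡ u +ℤ + o ⊎ u ≡ v +ℤ + o)
close⇒displacement {t} {u = u} {v} walk u≢v with walk⇒moves walk
... | m , bal with <-cmp (down t m) (up t m)
...   | tri< X<Y _ _ = let o , o>0 , disp , v≡u+o = increasing-displacement {t} {u = u} {v} m bal X<Y in
                       o , o>0 , disp , inj₁ v≡u+o
...   | tri≈ _ X≡Y _ = contradiction (sym (+ℤ-cancelʳ (+ down t m) (trans bal (cong (λ y → u +ℤ + y) (sym X≡Y))))) u≢v
...   | tri> _ _ Y<X = let o , o>0 , disp , u≡v+o = increasing-displacement {t} {u = v} {u} (reverse m) (sym bal) Y<X in
                       o , o>0 , disp , inj₂ u≡v+o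

packing-of-displacement-free : ∀ {t d k} (c : ℤ → Fin k) →
  (∀ u {o} → 0 < o → Displacement t d o → c (u +ℤ + o) ≢ c u) →
  IsSPackingColoring (G t) (λ _ → d) k c
packing-of-displacement-free c free u v u≢v same walk with close⇒displacement {u = u} {v} walk u≢v
... | o , o>0 , disp , inj₁ refl = free u o>0 disp (sym same)
... | o , o>0 , disp , inj₂ refl = free v o>0 disp same

fresh-colour : ∀ {M} (xs : List (Fin (suc M))) → length xs ≤ M → ∃[ c ] c ∉ xs
fresh-colour {M} xs few = Fin.¬∀⟶∃¬ (suc M) (_∈ xs) (λ c → DecMembership._∈?_ Fin._≟_ c xs) all-used
  where
  all-used : ¬ (∀ c → c ∈ xs)
  all-used ∈xs = <⇒≱ (s≤s few) (Fin.injective⇒≤ index-injective)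
    where
    index-injective : ∀ {c c′} → index (∈xs c) ≡ index (∈xs c′) → c ≡ c′
    index-injective {c} {c′} same =
      trans (lookup-index (∈xs c)) (trans (cong (lookup xs) same) (sym (lookup-index (∈xs c′))))

-- Vertex n avoids the colours of n − o for o ∈ os; when n − o < 0 that colour is before (o − n − 1).
module Greedy {M : ℕ} (os : List ℕ) (few : length os ≤ M) (before : ℕ → Fin (suc M)) where

  behind : (ℕ → Fin (suc M)) → ℕ → ℕ → Fin (suc M)
  behind h n o with o ≤? n
  ... | yes _ = h (n ∸ o)
  ... | no _ = before (o ∸ suc n)

  forbidden-few : ∀ h n → length (map (behind h n) os) ≤ M
  forbidden-few h n = subst (_≤ M) (sym (length-map _ os)) few

  pick : (ℕ → Fin (suc M)) → ℕ → Fin (suc M)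
  pick h n = proj₁ (fresh-colour (map (behind h n) os) (forbidden-few h n))

  pick-fresh : ∀ h n {o} → o ∈ os → pick h n ≢ behind h n o
  pick-fresh h n o∈os same =
    proj₂ (fresh-colour (map (behind h n) os) (forbidden-few h n)) (subst (_∈ map (behind h n) os) (sym same) (∈-map⁺ _ o∈os))

  -- table n j is the colour of j once 0 … n − 1 are coloured
  table : ℕ → ℕ → Fin (suc M)
  table zero _ = fzero
  table (suc n) j with j <? n
  ... | yes _ = table n j
  ... | no _ = pick (table n) n

  colour : ℕ → Fin (suc M)
  colour n = table (suc n) n

  colour≡pick : ∀ n → colour n ≡ pick (table n) n
  colour≡pick n with n <? n
  ... | yes n<n = contradiction n<n (<-irrefl refl)
  ... | no _ = refl

  table-stable : ∀ {n j} → j < n → table n j ≡ colour j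
  table-stable {suc n} {j} j<1+n with j <? n
  ... | yes j<n = table-stable j<n
  ... | no j≮n with m≤n⇒m<n∨m≡n (s≤s⁻¹ j<1+n)
  ...   | inj₁ j<n = contradiction j<n j≮n
  ...   | inj₂ refl = sym (colour≡pick j)

  colour-≢-behind : ∀ {n o} → o ∈ os → 0 < o → o ≤ n → colour n ≢ colour (n ∸ o)
  colour-≢-behind {n} {o} o∈os o>0 o≤n same = pick-fresh (table n) n o∈os (begin
    pick (table n) n     ≡⟨ sym (colour≡pick n) ⟩
    colour n             ≡⟨ same ⟩
    colour (n ∸ o)       ≡⟨ sym seen ⟩
    behind (table n) n o ∎)
    where
    open ≡-Reasoning
    seen : behind (table n) n o ≡ colour (n ∸ o)
    seen with o ≤? n
    ... | yes _ = table-stable (∸-monoʳ-< o>0 o≤n)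
    ... | no o≰n = contradiction o≤n o≰n

  colour-≢-before : ∀ {n o} → o ∈ os → n < o → colour n ≢ before (o ∸ suc n)
  colour-≢-before {n} {o} o∈os n<o same = pick-fresh (table n) n o∈os (trans (sym (colour≡pick n)) (trans same (sym seen)))
    where
    seen : behind (table n) n o ≡ before (o ∸ suc n)
    seen with o ≤? n
    ... | yes o≤n = contradiction o≤n (<⇒≱ n<o)
    ... | no _ = refl

greedy-colouring : ∀ {M} (os : List ℕ) → length os ≤ M →
  Σ[ c ∈ (ℤ → Fin (suc M)) ] (∀ u {o} → o ∈ os → 0 < o → c (u +ℤ + o) ≢ c u)
greedy-colouring os few = c , avoids
  where
  module Pos = Greedy os few (λ _ → fzero)
  module Neg = Greedy os few Pos.colour

  c : ℤ → Fin _
  c (+ n) = Pos.colour n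
  c -[1+ n ] = Neg.colour n

  avoids : ∀ u {o} → o ∈ os → 0 < o → c (u +ℤ + o) ≢ c u
  avoids (+ n) {o} o∈os o>0 same = Pos.colour-≢-behind o∈os o>0 (m≤n+m o n) (trans same (cong Pos.colour (sym (m+n∸n≡m n o))))
  avoids -[1+ n ] {o} o∈os o>0 same with o ≤? n
  ... | yes o≤n = Neg.colour-≢-behind o∈os o>0 o≤n (sym (trans (cong c (sym shifted)) same))
    where
    shifted : -[1+ n ] +ℤ + o ≡ -[1+ n ∸ o ]
    shifted = trans (ℤ.⊖-< (s≤s o≤n)) (cong (λ x → - + x) (+-∸-assoc 1 o≤n))
  ... | no o≰n = Neg.colour-≢-before o∈os (≰⇒> o≰n) (sym (trans (cong c (sym shifted)) same))
    where
    shifted : -[1+ n ] +ℤ + o ≡ + (o ∸ suc n)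
    shifted = ℤ.⊖-≥ (≰⇒> o≰n)

-- row t b w lists t * b + 2 * a for −w ≤ a ≤ w, as i = a + w runs through 0 … 2w;
-- offsets t d consists of 2a for 1 ≤ a ≤ d and the rows of b = d − w for w < d.
row : ℕ → ℕ → ℕ → List ℕ
row t b w = map (λ i → t * b + 2 * i ∸ 2 * w) (upTo (suc (2 * w)))

rows : ℕ → ℕ → ℕ → List ℕ
rows t d n = concatMap (λ w → row t (d ∸ w) w) (downFrom n)

offsets : ℕ → ℕ → List ℕ
offsets t d = map (λ a → 2 * suc a) (upTo d) ++ rows t d d

length-row : ∀ t b w → length (row t b w) ≡ suc (2 * w)
length-row t b w = trans (length-map _ (upTo (suc (2 * w)))) (length-upTo (suc (2 * w)))

length-rows : ∀ t d n → length (rows t d n) ≡ n * n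
length-rows t d zero = refl
length-rows t d (suc n) = begin
  length (row t (d ∸ n) n ++ rows t d n)          ≡⟨ length-++ (row t (d ∸ n) n) ⟩
  length (row t (d ∸ n) n) + length (rows t d n)  ≡⟨ cong₂ _+_ (length-row t (d ∸ n) n) (length-rows t d n) ⟩
  suc (2 * n) + n * n                             ≡⟨ odd+square n ⟩
  suc n * suc n                                   ∎
  where
  open ≡-Reasoning
  odd+square : ∀ n → suc (2 * n) + n * n ≡ suc n * suc n
  odd+square = ℕ-Solver.solve-∀

length-offsets : ∀ t d → length (offsets t d) ≡ d * (d + 1)
length-offsets t d = begin
  length (map (λ a → 2 * suc a) (upTo d) ++ rows t d d)          ≡⟨ length-++ (map (λ a → 2 * suc a) (upTo d)) ⟩
  length (map (λ a → 2 * suc a) (upTo d)) + length (rows t d d)  ≡⟨ cong₂ _+_ (trans (length-map _ (upTo d)) (length-upTo d)) (length-rows t d d) ⟩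
  d + d * d                                                      ≡⟨ d+d²≡d[d+1] d ⟩
  d * (d + 1)                                                    ∎
  where
  open ≡-Reasoning
  d+d²≡d[d+1] : ∀ d → d + d * d ≡ d * (d + 1)
  d+d²≡d[d+1] = ℕ-Solver.solve-∀

horizontal∈offsets : ∀ {t d o α α′} → 0 < o → o + 2 * α′ ≡ 2 * α → α ≤ d → o ∈ offsets t d
horizontal∈offsets {t} {d} {o} {α} {α′} o>0 bal α≤d with m≤n⇒∃[o]m+o≡n α′<α
  where
  α′<α : α′ < α
  α′<α = *-cancelˡ-< 2 α′ α (subst (2 * α′ <_) bal (m<n+m (2 * α′) o>0))
... | a , refl = ∈-++⁺ˡ {ys = rows t d d} (subst (_∈ map (λ a → 2 * suc a) (upTo d)) (sym o≡2[1+a]) (∈-map⁺ (λ a → 2 * suc a) (∈-upTo⁺ a<d)))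
  where
  o≡2[1+a] : o ≡ 2 * suc a
  o≡2[1+a] = +-cancelʳ-≡ (2 * α′) o (2 * suc a) (trans bal (shift α′ a))
    where
    shift : ∀ α′ a → 2 * (suc α′ + a) ≡ 2 * suc a + 2 * α′
    shift = ℕ-Solver.solve-∀
  a<d : a < d
  a<d = <-≤-trans (s≤s (m≤n+m a α′)) α≤d

row∈offsets : ∀ {t d o α α′ b} → o + 2 * α′ ≡ 2 * α + t * suc b → α + α′ + suc b ≤ d → o ∈ offsets t d
row∈offsets {t} {d} {o} {α} {α′} {b} bal count with m≤n⇒∃[o]m+o≡n count
... | σ , refl = ∈-++⁺ʳ _ (∈-concat⁺′ o∈row (∈-map⁺ (λ w → row t (d ∸ w) w) (∈-downFrom⁺ w<d)))
  where
  w i : ℕ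
  w = α + α′ + σ
  i = 2 * α + σ
  d≡w+1+b : α + α′ + suc b + σ ≡ w + suc b
  d≡w+1+b = regroup α α′ b σ
    where
    regroup : ∀ α α′ b σ → α + α′ + suc b + σ ≡ (α + α′ + σ) + suc b
    regroup = ℕ-Solver.solve-∀
  w<d : w < α + α′ + suc b + σ
  w<d = subst (w <_) (sym d≡w+1+b) (m<m+n w z<s)
  d∸w≡1+b : α + α′ + suc b + σ ∸ w ≡ suc b
  d∸w≡1+b = trans (cong (_∸ w) d≡w+1+b) (m+n∸m≡n w (suc b))
  i≤2w : i ≤ 2 * w
  i≤2w = subst (i ≤_) (widen α α′ σ) (m≤m+n i (2 * α′ + σ))
    where
    widen : ∀ α α′ σ → 2 * α + σ + (2 * α′ + σ) ≡ 2 * (α + α′ + σ)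
    widen = ℕ-Solver.solve-∀
  value : t * suc b + 2 * i ≡ o + 2 * w
  value = begin
    t * suc b + 2 * i                  ≡⟨ regroup₁ t b α σ ⟩
    (2 * α + t * suc b) + 2 * (α + σ)  ≡⟨ cong (_+ 2 * (α + σ)) (sym bal) ⟩
    (o + 2 * α′) + 2 * (α + σ)         ≡⟨ regroup₂ o α α′ σ ⟩
    o + 2 * w                          ∎
    where
    open ≡-Reasoning
    regroup₁ : ∀ t b α σ → t * suc b + 2 * (2 * α + σ) ≡ (2 * α + t * suc b) + 2 * (α + σ)
    regroup₁ = ℕ-Solver.solve-∀
    regroup₂ : ∀ o α α′ σ → (o + 2 * α′) + 2 * (α + σ) ≡ o + 2 * (α + α′ + σ)
    regroup₂ = ℕ-Solver.solve-∀
  o∈row : o ∈ row t (α + α′ + suc b + σ ∸ w) w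
  o∈row = subst (λ b′ → o ∈ row t b′ w) (sym d∸w≡1+b)
            (subst (_∈ row t (suc b) w) (trans (cong (_∸ 2 * w) value) (m+n∸n≡m o (2 * w)))
              (∈-map⁺ (λ i → t * suc b + 2 * i ∸ 2 * w) (∈-upTo⁺ (s≤s i≤2w))))

-- A net −t move would have to be made up by more than t/2 moves +2, too many when 2d ≤ t + 1.
no-net-backward-t : ∀ {t d o} → 2 * d ≤ t + 1 → ((moves α α′ β β′ _ , _) : Displacement t d o) → β′ ≤ β
no-net-backward-t {t} {d} {o} 2d≤t+1 (moves α α′ β β′ count , bal) with β′ ≤? β
... | yes β′≤β = β′≤β
... | no β′≰β with m≤n⇒∃[o]m+o≡n (≰⇒> β′≰β)
...   | g , refl = contradiction t≤2α (<⇒≱ 2α<t)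
  where
  t≤2α : t ≤ 2 * α
  t≤2α = +-cancelʳ-≤ (t * β) t (2 * α) (begin
    t + t * β                                ≤⟨ m≤n+m _ (o + 2 * α′ + t * g) ⟩
    o + 2 * α′ + t * g + (t + t * β)         ≡⟨ regroup o α′ t β g ⟩
    o + (2 * α′ + t * (suc β + g))           ≡⟨ bal ⟩
    2 * α + t * β                            ∎)
    where
    open ≤-Reasoning
    regroup : ∀ o α′ t β g → o + 2 * α′ + t * g + (t + t * β) ≡ o + (2 * α′ + t * (suc β + g))
    regroup = ℕ-Solver.solve-∀
  1+α≤d : suc α ≤ d
  1+α≤d = ≤-trans (subst (suc α ≤_) (regroup α α′ β g) (m≤m+n (suc α) (α′ + β + β + g))) count
    where
    regroup : ∀ α α′ β g → suc α + (α′ + β + β + g) ≡ α + α′ + β + (suc β + g)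
    regroup = ℕ-Solver.solve-∀
  2α<t : 2 * α < t
  2α<t = s<s⁻¹ (≤-trans (subst (_≤ 2 * d) (double α) (*-monoʳ-≤ 2 1+α≤d)) (subst (2 * d ≤_) (+-comm t 1) 2d≤t+1))
    where
    double : ∀ α → 2 * suc α ≡ suc (suc (2 * α))
    double = ℕ-Solver.solve-∀

net-displacement∈offsets : ∀ {t d o α α′} b → 0 < o → o + 2 * α′ ≡ 2 * α + t * b → α + α′ + b ≤ d → o ∈ offsets t d
net-displacement∈offsets {t} {d} {o} {α} {α′} zero o>0 net count =
  horizontal∈offsets {t} {d} {o} {α} {α′} o>0 (trans net (trans (cong (λ x → 2 * α + x) (*-zeroʳ t)) (+-identityʳ _)))
    (≤-trans (≤-trans (m≤m+n α α′) (m≤m+n _ 0)) count)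
net-displacement∈offsets {t} {d} {o} {α} {α′} (suc b) _ net count = row∈offsets {t} {d} {o} {α} {α′} net count

displacement∈offsets : ∀ {t d o} → 2 * d ≤ t + 1 → 0 < o → Displacement t d o → o ∈ offsets t d
displacement∈offsets {t} {d} {o} 2d≤t+1 o>0 disp@(moves α α′ β β′ count , bal)
  with m≤n⇒∃[o]m+o≡n (no-net-backward-t {t} {d} {o} 2d≤t+1 disp)
... | b , refl = net-displacement∈offsets {t} {d} {o} {α} {α′} b o>0 net net-count
  where
  net : o + 2 * α′ ≡ 2 * α + t * b
  net = +-cancelʳ-≡ (t * β′) _ _ (trans (regroup₁ o α′ t β′) (trans bal (regroup₂ α t β′ b)))
    where
    regroup₁ : ∀ o α′ t β′ → o + 2 * α′ + t * β′ ≡ o + (2 * α′ + t * β′)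
    regroup₁ = ℕ-Solver.solve-∀
    regroup₂ : ∀ α t β′ b → 2 * α + t * (β′ + b) ≡ 2 * α + t * b + t * β′
    regroup₂ = ℕ-Solver.solve-∀
  net-count : α + α′ + b ≤ d
  net-count = ≤-trans (subst (α + α′ + b ≤_) (regroup α α′ β′ b) (m≤m+n _ (β′ + β′))) count
    where
    regroup : ∀ α α′ β′ b → α + α′ + b + (β′ + β′) ≡ α + α′ + (β′ + b) + β′
    regroup = ℕ-Solver.solve-∀

small-distance-colouring : ∀ {t d} → 2 * d ≤ t + 1 → ∃ (IsSPackingColoring (G t) (λ _ → d) (1 + d * (d + 1)))
small-distance-colouring {t} {d} 2d≤t+1 with greedy-colouring (offsets t d) (≤-reflexive (length-offsets t d))
... | c , avoids = c , packing-of-displacement-free c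
                         (λ u o>0 disp → avoids u (displacement∈offsets 2d≤t+1 o>0 disp) o>0)

period : ℕ → ℕ → ℕ → ℕ
period n d b = 2 + 2 * d + (2 * n + 1) * b

-- Here t = 2n + 3, so that 2n + 1 = t − 2.
short-of-period : ∀ n b α α′ β β′ σ g → β + g ≡ β′ + b →
  period n (α + α′ + β + β′ + σ) b + (2 * α′ + (2 * n + 3) * β′) ≢ 2 * α + (2 * n + 3) * β
short-of-period n b α α′ β β′ σ g short bal = m+1+n≢m R′ (sym (begin
  R′                               ≡⟨ cong (λ x → R + (2 * n + 1) * x) (sym short) ⟩
  R + (2 * n + 1) * (β + g)        ≡⟨ cong (_+ (2 * n + 1) * (β + g)) (sym bal) ⟩
  L + (2 * n + 1) * (β + g)        ≡⟨ regroup n b α α′ β β′ σ g ⟩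
  R′ + suc K                       ∎))
  where
  open ≡-Reasoning
  L R R′ K : ℕ
  L = period n (α + α′ + β + β′ + σ) b + (2 * α′ + (2 * n + 3) * β′)
  R = 2 * α + (2 * n + 3) * β
  R′ = R + (2 * n + 1) * (β′ + b)
  K = 4 * α′ + 4 * β′ + 2 * σ + 1 + (2 * n + 1) * g
  regroup : ∀ n b α α′ β β′ σ g →
    2 + 2 * (α + α′ + β + β′ + σ) + (2 * n + 1) * b + (2 * α′ + (2 * n + 3) * β′) + (2 * n + 1) * (β + g)
    ≡ 2 * α + (2 * n + 3) * β + (2 * n + 1) * (β′ + b) + suc (4 * α′ + 4 * β′ + 2 * σ + 1 + (2 * n + 1) * g)
  regroup = ℕ-Solver.solve-∀

off-period-parity : ∀ n d b α α′ β′ →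
  period n d b + (2 * α′ + (2 * n + 3) * β′) ≢ 2 * α + (2 * n + 3) * suc (β′ + b)
off-period-parity n d b α α′ β′ bal = even≢odd x z (+-cancelʳ-≡ (b + β′) (2 * x) (suc (2 * z)) (begin
  2 * x + (b + β′)                                    ≡⟨ even-part n d b α′ β′ ⟩
  period n d b + (2 * α′ + (2 * n + 3) * β′)          ≡⟨ bal ⟩
  2 * α + (2 * n + 3) * suc (β′ + b)                  ≡⟨ odd-part n b α β′ ⟩
  suc (2 * z) + (b + β′)                              ∎))
  where
  open ≡-Reasoning
  x z : ℕ
  x = 1 + d + n * b + α′ + (n + 1) * β′
  z = α + (n + 1) * (β′ + b) + n + 1
  even-part : ∀ n d b α′ β′ →
    2 * (1 + d + n * b + α′ + (n + 1) * β′) + (b + β′) ≡ 2 + 2 * d + (2 * n + 1) * b + (2 * α′ + (2 * n + 3) * β′)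
  even-part = ℕ-Solver.solve-∀
  odd-part : ∀ n b α β′ → 2 * α + (2 * n + 3) * suc (β′ + b) ≡ suc (2 * (α + (n + 1) * (β′ + b) + n + 1)) + (b + β′)
  odd-part = ℕ-Solver.solve-∀

beyond-period : ∀ n b α α′ β′ σ g r →
  2 * (α + α′ + (suc (β′ + b) + suc g) + β′ + σ) + r ≡ 2 * b + (2 * n + 3) →
  period n (α + α′ + (suc (β′ + b) + suc g) + β′ + σ) b + (2 * α′ + (2 * n + 3) * β′) ≢ 2 * α + (2 * n + 3) * (suc (β′ + b) + suc g)
beyond-period n b α α′ β′ σ g r slack bal = m+1+n≢m (L + 2 * Q) (sym (begin
  L + 2 * Q        ≡⟨ cong (_+ 2 * Q) bal ⟩
  R + 2 * Q        ≡⟨ cong (λ x → R + 2 * x) (sym slack) ⟩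
  R + 2 * P        ≡⟨ regroup n b α α′ β′ σ g r ⟩
  L + 2 * Q + suc K ∎))
  where
  open ≡-Reasoning
  d L R P Q K : ℕ
  d = α + α′ + (suc (β′ + b) + suc g) + β′ + σ
  L = period n d b + (2 * α′ + (2 * n + 3) * β′)
  R = 2 * α + (2 * n + 3) * (suc (β′ + b) + suc g)
  P = 2 * d + r
  Q = 2 * b + (2 * n + 3)
  K = (2 * n + 1) * g + 4 * α + 4 * β′ + 4 * g + 2 * σ + 2 * r + 1
  regroup : ∀ n b α α′ β′ σ g r →
    2 * α + (2 * n + 3) * (suc (β′ + b) + suc g) + 2 * (2 * (α + α′ + (suc (β′ + b) + suc g) + β′ + σ) + r)
    ≡ 2 + 2 * (α + α′ + (suc (β′ + b) + suc g) + β′ + σ) + (2 * n + 1) * b + (2 * α′ + (2 * n + 3) * β′)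
      + 2 * (2 * b + (2 * n + 3))
      + suc ((2 * n + 1) * g + 4 * α + 4 * β′ + 4 * g + 2 * σ + 2 * r + 1)
  regroup = ℕ-Solver.solve-∀

period-not-displacement : ∀ {n d b} → 2 * d ≤ 2 * b + (2 * n + 3) → ¬ Displacement (2 * n + 3) d (period n d b)
period-not-displacement {n} {d} {b} 2d≤2b+t (moves α α′ β β′ count , bal) with m≤n⇒∃[o]m+o≡n count
... | σ , refl with β ≤? β′ + b
...   | yes β≤β′+b = let g , short = m≤n⇒∃[o]m+o≡n β≤β′+b in short-of-period n b α α′ β β′ σ g short bal
...   | no β≰β′+b with m≤n⇒∃[o]m+o≡n (≰⇒> β≰β′+b)
...     | zero , refl = off-period-parity n (α + α′ + (suc (β′ + b) + 0) + β′ + σ) b α α′ β′ (trans bal (cong (λ x → 2 * α + (2 * n + 3) * x) (+-identityʳ _)))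
...     | suc g , refl = let r , slack = m≤n⇒∃[o]m+o≡n 2d≤2b+t in beyond-period n b α α′ β′ σ g r slack bal

displacement≤ : ∀ {t d o} → 2 ≤ t → Displacement t d o → o ≤ t * d
displacement≤ {t} {d} {o} 2≤t (moves α α′ β β′ count , bal) = begin
  o                       ≤⟨ m≤m+n o _ ⟩
  o + (2 * α′ + t * β′)   ≡⟨ bal ⟩
  2 * α + t * β           ≤⟨ +-monoˡ-≤ (t * β) (*-monoˡ-≤ α 2≤t) ⟩
  t * α + t * β           ≡⟨ sym (*-distribˡ-+ t α β) ⟩
  t * (α + β)             ≤⟨ *-monoʳ-≤ t α+β≤d ⟩
  t * d                   ∎
  where
  open ≤-Reasoning
  α+β≤d : α + β ≤ d
  α+β≤d = ≤-trans (subst (α + β ≤_) (regroup α α′ β β′) (m≤m+n (α + β) (α′ + β′))) count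
    where
    regroup : ∀ α α′ β β′ → α + β + (α′ + β′) ≡ α + α′ + β + β′
    regroup = ℕ-Solver.solve-∀

residue : (p : ℕ) .{{_ : NonZero p}} → ℤ → Fin p
residue p u = fromℕ< (n%ℕd<d u p)

same-residue⇒multiple : ∀ p .{{_ : NonZero p}} u o → residue p (u +ℤ + o) ≡ residue p u → ∃[ q ] + o ≡ q *ℤ + p
same-residue⇒multiple p u o same = (u +ℤ + o) /ℕ p - u /ℕ p , (begin
  + o                                               ≡⟨ o≡[u+o]-u u (+ o) ⟩
  (u +ℤ + o) - u                                    ≡⟨ cong₂ _-_ (a≡a%ℕn+[a/ℕn]*n (u +ℤ + o) p) (a≡a%ℕn+[a/ℕn]*n u p) ⟩
  (+ r′ +ℤ (u +ℤ + o) /ℕ p *ℤ + p) - (+ r +ℤ u /ℕ p *ℤ + p)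
                                                    ≡⟨ cong (λ x → (+ x +ℤ (u +ℤ + o) /ℕ p *ℤ + p) - (+ r +ℤ u /ℕ p *ℤ + p)) r′≡r ⟩
  (+ r +ℤ (u +ℤ + o) /ℕ p *ℤ + p) - (+ r +ℤ u /ℕ p *ℤ + p)
                                                    ≡⟨ difference (+ r) (u /ℕ p) ((u +ℤ + o) /ℕ p) (+ p) ⟩
  ((u +ℤ + o) /ℕ p - u /ℕ p) *ℤ + p                 ∎)
  where
  open ≡-Reasoning
  r r′ : ℕ
  r = u %ℕ p
  r′ = (u +ℤ + o) %ℕ p
  r′≡r : r′ ≡ r
  r′≡r = Fin.fromℕ<-injective r′ r (n%ℕd<d (u +ℤ + o) p) (n%ℕd<d u p) same
  o≡[u+o]-u : ∀ u o → o ≡ (u +ℤ o) - u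
  o≡[u+o]-u = ℤ-Solver.solve-∀
  difference : ∀ r a b p → (r +ℤ b *ℤ p) - (r +ℤ a *ℤ p) ≡ (b - a) *ℤ p
  difference = ℤ-Solver.solve-∀

ℕ-multiple-below-double : ∀ {o p} q → o ≡ q * p → 0 < o → o < 2 * p → o ≡ p
ℕ-multiple-below-double zero refl () _
ℕ-multiple-below-double {p = p} (suc zero) refl _ _ = +-identityʳ p
ℕ-multiple-below-double {p = p} (suc (suc k)) refl _ o<2p =
  contradiction o<2p (≤⇒≯ (+-monoʳ-≤ p (+-monoʳ-≤ p z≤n)))

multiple-below-double : ∀ {o p} q → + o ≡ q *ℤ + p → 0 < o → o < 2 * p → o ≡ p
multiple-below-double {o} {p} (+ q) o≡qp =
  ℕ-multiple-below-double q (ℤ.+-injective (trans o≡qp (sym (ℤ.pos-* q p))))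
multiple-below-double {p = zero} -[1+ k ] _ _ ()
multiple-below-double {p = suc p} -[1+ k ] () _ _

cyclic-packing : ∀ {t d p} .{{_ : NonZero p}} → 2 ≤ t → t * d < 2 * p → ¬ Displacement t d p →
  IsSPackingColoring (G t) (λ _ → d) p (residue p)
cyclic-packing {t} {d} {p} 2≤t td<2p not-displacement = packing-of-displacement-free (residue p) avoids
  where
  avoids : ∀ u {o} → 0 < o → Displacement t d o → residue p (u +ℤ + o) ≢ residue p u
  avoids u {o} o>0 disp same =
    let q , o≡qp = same-residue⇒multiple p u o same
        o<2p = ≤-<-trans (displacement≤ 2≤t disp) td<2p
    in not-displacement (subst (Displacement t d) (multiple-below-double q o≡qp o>0 o<2p) disp)

even-or-odd : ∀ n → ∃[ k ] (n ≡ 2 * k ⊎ n ≡ suc (2 * k))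
even-or-odd zero = 0 , inj₁ refl
even-or-odd (suc n) with even-or-odd n
... | k , inj₁ refl = k , inj₂ refl
... | k , inj₂ refl = suc k , inj₁ (double k)
  where
  double : ∀ k → suc (suc (2 * k)) ≡ 2 * suc k
  double = ℕ-Solver.solve-∀

≤-via-slack : ∀ {m n k} → m + k ≡ n → m ≤ n
≤-via-slack {m} {k = k} refl = m≤m+n m k

good-period : ∀ n {d} → n + 2 ≤ d → ∃[ b ] (
  2 * d ≤ 2 * b + (2 * n + 3) ×
  (2 * n + 3) * d < 2 * period n d b ×
  4 * period n d b + (2 * n + 3) * (2 * n + 3) ≤ 4 * (2 * n + 3) * d + 2 * (2 * n + 3) + 7)
good-period n n+2≤d with m≤n⇒∃[o]m+o≡n n+2≤d | even-or-odd n
... | D , refl | k , inj₁ refl =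
  k + 1 + D , ≤-via-slack (a k D) , ≤-via-slack (b k D) , ≤-via-slack (c k D)
  where
  a : ∀ k D → 2 * (2 * k + 2 + D) + (2 * k + 1) ≡ 2 * (k + 1 + D) + (2 * (2 * k) + 3)
  a = ℕ-Solver.solve-∀
  b : ∀ k D → suc ((2 * (2 * k) + 3) * (2 * k + 2 + D)) + (4 * k + 7 + (4 * k + 3) * D)
            ≡ 2 * (2 + 2 * (2 * k + 2 + D) + (2 * (2 * k) + 1) * (k + 1 + D))
  b = ℕ-Solver.solve-∀
  c : ∀ k D → 4 * (2 + 2 * (2 * k + 2 + D) + (2 * (2 * k) + 1) * (k + 1 + D)) + (2 * (2 * k) + 3) * (2 * (2 * k) + 3) + 4 * k
            ≡ 4 * (2 * (2 * k) + 3) * (2 * k + 2 + D) + 2 * (2 * (2 * k) + 3) + 7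
  c = ℕ-Solver.solve-∀
... | D , refl | k , inj₂ refl =
  k + 1 + D , ≤-via-slack (a k D) , ≤-via-slack (b k D) , ≤-via-slack (c k D)
  where
  a : ∀ k D → 2 * (suc (2 * k) + 2 + D) + (2 * k + 1) ≡ 2 * (k + 1 + D) + (2 * suc (2 * k) + 3)
  a = ℕ-Solver.solve-∀
  b : ∀ k D → suc ((2 * suc (2 * k) + 3) * (suc (2 * k) + 2 + D)) + (6 + (4 * k + 5) * D)
            ≡ 2 * (2 + 2 * (suc (2 * k) + 2 + D) + (2 * suc (2 * k) + 1) * (k + 1 + D))
  b = ℕ-Solver.solve-∀
  c : ∀ k D → 4 * (2 + 2 * (suc (2 * k) + 2 + D) + (2 * suc (2 * k) + 1) * (k + 1 + D))
              + (2 * suc (2 * k) + 3) * (2 * suc (2 * k) + 3) + (12 * k + 8)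
            ≡ 4 * (2 * suc (2 * k) + 3) * (suc (2 * k) + 2 + D) + 2 * (2 * suc (2 * k) + 3) + 7
  c = ℕ-Solver.solve-∀

large-distance-colouring : ∀ {t d} n → t ≡ 2 * n + 3 → n + 2 ≤ d →
  ∃[ k ] (4 * k + t * t ≤ 4 * t * d + 2 * t + 7 × ∃ (IsSPackingColoring (G t) (λ _ → d) k))
large-distance-colouring {d = d} n refl n+2≤d with good-period n n+2≤d
... | b , 2d≤2b+t , td<2p , bounded =
  period n d b , bounded , residue (period n d b) ,
  cyclic-packing (≤-trans (m≤m+n 2 1) (m≤n+m 3 (2 * n))) td<2p (period-not-displacement {n} {d} {b} 2d≤2b+t)

odd⇒≡2n+3 : ∀ {t} → 3 ≤ t → t % 2 ≡ 1 → ∃[ n ] t ≡ 2 * n + 3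
odd⇒≡2n+3 {t} 3≤t t%2≡1 with even-or-odd t
... | k , inj₁ refl = contradiction (trans (sym (trans (cong (_% 2) (*-comm 2 k)) (m*n%n≡0 k 2))) t%2≡1) λ ()
... | zero , inj₂ refl = contradiction 3≤t λ { (s≤s ()) }
... | suc n , inj₂ refl = n , shift n
  where
  shift : ∀ n → suc (2 * suc n) ≡ 2 * n + 3
  shift = ℕ-Solver.solve-∀

ℕ-bound⇒ℤ-bound : ∀ {x a s b c} → x + s ≤ a + b + c → + x ≤ℤ + a - + s +ℤ + b +ℤ + c
ℕ-bound⇒ℤ-bound {x} {a} {s} {b} {c} x+s≤ = subst (+ x ≤ℤ_) (sym (begin
  + a - + s +ℤ + b +ℤ + c        ≡⟨ regroup (+ a) (+ s) (+ b) (+ c) ⟩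
  + a +ℤ + b +ℤ + c - + s        ≡⟨ cong (λ y → y - + s) (sym (trans (ℤ.pos-+ (a + b) c) (cong (_+ℤ + c) (ℤ.pos-+ a b)))) ⟩
  + (a + b + c) - + s            ≡⟨ ℤ.m-n≡m⊖n (a + b + c) s ⟩
  (a + b + c) ⊖ s                ≡⟨ ℤ.⊖-≥ (≤-trans (m≤n+m s x) x+s≤) ⟩
  + (a + b + c ∸ s)              ∎)) (+≤+ (m+n≤o⇒m≤o∸n x x+s≤))
  where
  open ≡-Reasoning
  regroup : ∀ a s b c → a - s +ℤ b +ℤ c ≡ a +ℤ b +ℤ c - s
  regroup = ℤ-Solver.solve-∀

half-of-t+1≤ : ∀ n {d} → 2 * n + 3 + 1 ≤ 2 * d → n + 2 ≤ d
half-of-t+1≤ n {d} = *-cancelˡ-≤ 2 ∘ subst (_≤ 2 * d) (twice n)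
  where
  twice : ∀ n → 2 * n + 3 + 1 ≡ 2 * (n + 2)
  twice = ℕ-Solver.solve-∀

theorem6 : (t d : ℕ) → 3 ≤ t → t % 2 ≡ 1 → 1 ≤ d →
    (2 * d ≤ t + 1 → χ≤ (G t) (λ _ → d) (1 + d * (d + 1))) ×
    (t + 1 ≤ 2 * d →
      ∃ λ k → (+ (4 * k) ≤ℤ (+ (4 * t * d)) - (+ (t * t)) +ℤ (+ (2 * t)) +ℤ (+ 7))
        × ∃ (IsSPackingColoring (G t) (λ _ → d) k))
theorem6 t d 3≤t t-odd _ = small , large
  where
  small : 2 * d ≤ t + 1 → χ≤ (G t) (λ _ → d) (1 + d * (d + 1))
  small 2d≤t+1 = 1 + d * (d + 1) , ≤-refl , small-distance-colouring 2d≤t+1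
  large : t + 1 ≤ 2 * d → ∃ λ k → (+ (4 * k) ≤ℤ (+ (4 * t * d)) - (+ (t * t)) +ℤ (+ (2 * t)) +ℤ (+ 7))
                                  × ∃ (IsSPackingColoring (G t) (λ _ → d) k)
  large t+1≤2d =
    let n , t≡2n+3 = odd⇒≡2n+3 3≤t t-odd
        k , bounded , colouring = large-distance-colouring n t≡2n+3
                                    (half-of-t+1≤ n (subst (λ t → t + 1 ≤ 2 * d) t≡2n+3 t+1≤2d))
    in k , ℕ-bound⇒ℤ-bound bounded , colouring
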